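{- Let $\beta,\gamma$ be arbitrary (complex) numbers, and let $(a_n)_{n\ge0}$ be defined by \[ \sum_{n\ge0}a_nx^n = \frac{1}{1-\beta x+(\beta^2-\gamma)x^2-x^3}. \] Then $(a_n)$ is fixed by $\mathcal{L}^2$, i.e. $\mathcal{L}(\mathcal{L}(a_n))=(a_n)$. Moreover $a_0=1$, $a_1=\beta$, $a_2=\gamma$.
   Context: For a sequence $(a_n)_{n\ge0}$, $\mathcal{L}$ denotes the operator sending $(a_n)$ to $(a_n^2-a_{n-1}a_{n+1})_{n\ge0}$, with the convention that the term of index $-1$ is $0$. -}

module Defs where

open import Level using (Level)
open import Data.Nat using (ℕ; zero; suc; _∸_)
open import Algebra.Bundles using (CommutativeRing)

module Seq {c ℓ : Level} (R : CommutativeRing c ℓ) where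
  open CommutativeRing R using (Carrier; _≈_; _+_; _*_; -_; _-_; 0#; 1#)

  -- formal power series / sequences over R: n ↦ coefficient of x^n
  Series : Set c
  Series = ℕ → Carrier

  sumUpTo : ℕ → (ℕ → Carrier) → Carrier
  sumUpTo zero    f = f zero
  sumUpTo (suc n) f = sumUpTo n f + f (suc n)

  _⋆_ : Series → Series → Series
  (f ⋆ g) n = sumUpTo n (λ k → f k * g (n ∸ k))

  oneS : Series
  oneS zero    = 1#
  oneS (suc _) = 0#

  denom : Carrier → Carrier → Series
  denom β γ 0 = 1#
  denom β γ 1 = - β
  denom β γ 2 = (β * β) - γ
  denom β γ 3 = - 1#
  denom β γ (suc (suc (suc (suc _)))) = 0#

  -- a has generating function 1 / denom β γ, i.e. denom β γ · A = 1
  HasGF : Carrier → Carrier → Series → Set ℓ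
  HasGF β γ a = ∀ n → (denom β γ ⋆ a) n ≈ oneS n

  -- the operator 𝓛 : (a_n) ↦ (a_n² - a_{n-1} a_{n+1}), with a_{-1} = 0
  𝓛 : Series → Series
  𝓛 a zero    = a zero * a zero - 0# * a 1
  𝓛 a (suc n) = a (suc n) * a (suc n) - a n * a (suc (suc n))

module Submission where

-- Theorem 4.1.  Put e₁ = β and e₂ = β² - γ, so the denominator is 1 - e₁x + e₂x² - x³.
-- Its coefficient sequence is characterised by a₀ = 1 together with the recurrence
-- a_{n+3} = e₁a_{n+2} - e₂a_{n+1} + a_n, read with a₋₂ = a₋₁ = 0 (CoefficientSequence).
--
-- The heart of the proof is a polynomial identity (Δ-next-identity): if six
-- consecutive terms satisfy the (e₁,e₂)-recurrence, then the quantities y² - xz of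
-- consecutive triples satisfy the (e₂,e₁)-recurrence.  As (𝓛a)_n is such a quantity,
-- 𝓛 maps the coefficient sequence for (e₁,e₂) to the one for (e₂,e₁), after checking
-- the first two values (𝓛-coefficientSequence).  Applying this twice, 𝓛(𝓛a) is again
-- a coefficient sequence for (e₁,e₂), hence equals a, since the recurrence and a₀
-- determine the sequence (coefficientSequence-unique).  The values a₁ = β, a₂ = γ
-- are read off from the recurrence.

open import Defs
open import Level using (Level; 0ℓ)
open import Data.Nat as ℕ using (ℕ; zero; suc; _∸_)
import Data.Nat.Properties as ℕ
open import Data.Product using (_×_; _,_; proj₁)
open import Data.Maybe using (Maybe; just; nothing)
open import Relation.Nullary using (yes; no)
open import Relation.Binary.PropositionalEquality as ≡ using (_≡_)
open import Algebra.Bundles using (CommutativeRing; RawRing)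
open import Algebra.Solver.Ring.AlmostCommutativeRing using (AlmostCommutativeRing; fromCommutativeRing; _-Raw-AlmostCommutative⟶_)
import Algebra.Solver.Ring as RingSolver

-- The ring solver for an arbitrary commutative ring R, with integer coefficients:
-- the pair (p , n) of natural numbers stands for the integer p - n.
module IntegerCoefficientSolver {c ℓ : Level} (R : CommutativeRing c ℓ) where
  open CommutativeRing R
  open import Algebra.Properties.Semiring.Mult semiring using (×-homo-+; ×1-homo-*) renaming (_×_ to _×ₙ_)
  open import Algebra.Properties.Group +-group using (x∙y⁻¹≈ε⇒x≈y; x≈y⇒x∙y⁻¹≈ε; ε⁻¹≈ε)
  open import Algebra.Properties.AbelianGroup +-abelianGroup using (⁻¹-anti-homo‿-; ⁻¹-∙-comm)
  open import Algebra.Properties.CommutativeSemigroup +-commutativeSemigroup using (interchange)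
  open import Algebra.Properties.Ring ring using (x[y-z]≈xy-xz; [y-z]x≈yx-zx)
  open import Relation.Binary.Reasoning.Setoid setoid

  Diff : Set
  Diff = ℕ × ℕ

  -- The canonical representative of p - n has a zero component; normalising after
  -- each operation makes equal integer coefficients syntactically equal.
  canonical : Diff → Diff
  canonical (p , n) = (p ∸ n , n ∸ p)

  integers : RawRing 0ℓ 0ℓ
  integers = record
    { Carrier = Diff
    ; _≈_     = _≡_
    ; _+_     = λ { (p , n) (q , m) → canonical (p ℕ.+ q , n ℕ.+ m) }
    ; _*_     = λ { (p , n) (q , m) → canonical (p ℕ.* q ℕ.+ n ℕ.* m , p ℕ.* m ℕ.+ n ℕ.* q) }
    ; -_      = λ { (p , n) → (n , p) }
    ; 0#      = (0 , 0)
    ; 1#      = (1 , 0)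
    }

  ⟦_⟧ℤ : Diff → Carrier
  ⟦ p , n ⟧ℤ = p ×ₙ 1# - n ×ₙ 1#

  sub-+-sub : ∀ A B C D → (A - B) + (C - D) ≈ (A + C) - (B + D)
  sub-+-sub A B C D = trans (interchange A (- B) C (- D)) (+-congˡ (⁻¹-∙-comm B D))

  sub-*-sub : ∀ A B C D → (A - B) * (C - D) ≈ (A * C + B * D) - (A * D + B * C)
  sub-*-sub A B C D = begin
    (A - B) * (C - D)                   ≈⟨ [y-z]x≈yx-zx (C - D) A B ⟩
    A * (C - D) - B * (C - D)           ≈⟨ +-cong (x[y-z]≈xy-xz A C D) (-‿cong (x[y-z]≈xy-xz B C D)) ⟩
    (A * C - A * D) - (B * C - B * D)   ≈⟨ +-congˡ (⁻¹-anti-homo‿- (B * C) (B * D)) ⟩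
    (A * C - A * D) + (B * D - B * C)   ≈⟨ sub-+-sub (A * C) (A * D) (B * D) (B * C) ⟩
    (A * C + B * D) - (A * D + B * C)   ∎

  sub-≈ : ∀ A B C D → A + D ≈ C + B → A - B ≈ C - D
  sub-≈ A B C D eq = x∙y⁻¹≈ε⇒x≈y (A - B) (C - D) (begin
    (A - B) - (C - D)   ≈⟨ +-congˡ (⁻¹-anti-homo‿- C D) ⟩
    (A - B) + (D - C)   ≈⟨ sub-+-sub A B D C ⟩
    (A + D) - (B + C)   ≈⟨ +-congˡ (-‿cong (+-comm B C)) ⟩
    (A + D) - (C + B)   ≈⟨ x≈y⇒x∙y⁻¹≈ε eq ⟩
    0#                  ∎)

  ⟦⟧-cross : ∀ p n q m → p ℕ.+ m ≡ q ℕ.+ n → ⟦ p , n ⟧ℤ ≈ ⟦ q , m ⟧ℤ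
  ⟦⟧-cross p n q m eq = sub-≈ _ _ _ _ (begin
    p ×ₙ 1# + m ×ₙ 1#   ≈⟨ ×-homo-+ 1# p m ⟨
    (p ℕ.+ m) ×ₙ 1#     ≡⟨ ≡.cong (_×ₙ 1#) eq ⟩
    (q ℕ.+ n) ×ₙ 1#     ≈⟨ ×-homo-+ 1# q n ⟩
    q ×ₙ 1# + n ×ₙ 1#   ∎)

  ⟦canonical⟧ : ∀ d → ⟦ canonical d ⟧ℤ ≈ ⟦ d ⟧ℤ
  ⟦canonical⟧ (p , n) = ⟦⟧-cross (p ∸ n) (n ∸ p) p n (balance p n)
    where
    balance : ∀ p n → (p ∸ n) ℕ.+ n ≡ p ℕ.+ (n ∸ p)
    balance zero    zero    = ≡.refl
    balance zero    (suc n) = ≡.refl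
    balance (suc p) zero    = ≡.refl
    balance (suc p) (suc n) = ≡.trans (ℕ.+-suc (p ∸ n) n) (≡.cong suc (balance p n))

  ×1-homo-+* : ∀ p q n m → (p ℕ.* q ℕ.+ n ℕ.* m) ×ₙ 1# ≈ p ×ₙ 1# * q ×ₙ 1# + n ×ₙ 1# * m ×ₙ 1#
  ×1-homo-+* p q n m = trans (×-homo-+ 1# (p ℕ.* q) (n ℕ.* m)) (+-cong (×1-homo-* p q) (×1-homo-* n m))

  ACR : AlmostCommutativeRing c ℓ
  ACR = fromCommutativeRing R

  ⟦⟧-homomorphism : integers -Raw-AlmostCommutative⟶ ACR
  ⟦⟧-homomorphism = record
    { ⟦_⟧    = ⟦_⟧ℤ
    ; +-homo = λ { (p , n) (q , m) → begin
        ⟦ canonical (p ℕ.+ q , n ℕ.+ m) ⟧ℤ     ≈⟨ ⟦canonical⟧ (p ℕ.+ q , n ℕ.+ m) ⟩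
        (p ℕ.+ q) ×ₙ 1# - (n ℕ.+ m) ×ₙ 1#     ≈⟨ +-cong (×-homo-+ 1# p q) (-‿cong (×-homo-+ 1# n m)) ⟩
        (p ×ₙ 1# + q ×ₙ 1#) - (n ×ₙ 1# + m ×ₙ 1#)
                                               ≈⟨ sub-+-sub _ _ _ _ ⟨
        ⟦ p , n ⟧ℤ + ⟦ q , m ⟧ℤ                ∎ }
    ; *-homo = λ { (p , n) (q , m) → begin
        ⟦ canonical (p ℕ.* q ℕ.+ n ℕ.* m , p ℕ.* m ℕ.+ n ℕ.* q) ⟧ℤ
                                               ≈⟨ ⟦canonical⟧ (p ℕ.* q ℕ.+ n ℕ.* m , p ℕ.* m ℕ.+ n ℕ.* q) ⟩
        (p ℕ.* q ℕ.+ n ℕ.* m) ×ₙ 1# - (p ℕ.* m ℕ.+ n ℕ.* q) ×ₙ 1#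
                                               ≈⟨ +-cong (×1-homo-+* p q n m) (-‿cong (×1-homo-+* p m n q)) ⟩
        _                                      ≈⟨ sub-*-sub _ _ _ _ ⟨
        ⟦ p , n ⟧ℤ * ⟦ q , m ⟧ℤ                ∎ }
    ; -‿homo = λ { (p , n) → sym (⁻¹-anti-homo‿- (p ×ₙ 1#) (n ×ₙ 1#)) }
    ; 0-homo = -‿inverseʳ 0#
    ; 1-homo = trans (+-cong (+-identityʳ 1#) ε⁻¹≈ε) (+-identityʳ 1#)
    }

  -- Equality of integer coefficients is decidable, which lets the solver
  -- recognise cancelling monomials.
  ⟦⟧-≟ : ∀ d e → Maybe (⟦ d ⟧ℤ ≈ ⟦ e ⟧ℤ)
  ⟦⟧-≟ (p , n) (q , m) with p ℕ.+ m ℕ.≟ q ℕ.+ n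
  ... | yes eq = just (⟦⟧-cross p n q m eq)
  ... | no  _  = nothing

  open RingSolver integers ACR ⟦⟧-homomorphism ⟦⟧-≟ public
    using (Polynomial; solve; _:=_; _:+_; _:*_; _:-_; :-_)

module CoefficientSequences {c ℓ : Level} (R : CommutativeRing c ℓ) where
  open CommutativeRing R
  open Seq R
  open IntegerCoefficientSolver R
  open import Algebra.Properties.Ring ring using (-0#≈0#; -1*x≈-x)
  open import Relation.Binary.Reasoning.Setoid setoid

  -- One step of the recurrence with characteristic polynomial t³ - e₁t² + e₂t - 1:
  -- the term following x, y, z.
  next : Carrier → Carrier → Carrier → Carrier → Carrier → Carrier
  next e₁ e₂ z y x = e₁ * z - e₂ * y + x

  next-cong : ∀ e₁ e₂ {z z′ y y′ x x′} → z ≈ z′ → y ≈ y′ → x ≈ x′ →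
              next e₁ e₂ z y x ≈ next e₁ e₂ z′ y′ x′
  next-cong e₁ e₂ z≈ y≈ x≈ = +-cong (+-cong (*-congˡ z≈) (-‿cong (*-congˡ y≈))) x≈

  Δ : Carrier → Carrier → Carrier → Carrier
  Δ x y z = y * y - x * z

  Δ-cong : ∀ {x x′ y y′ z z′} → x ≈ x′ → y ≈ y′ → z ≈ z′ → Δ x y z ≈ Δ x′ y′ z′
  Δ-cong x≈ y≈ z≈ = +-cong (*-cong y≈ y≈) (-‿cong (*-cong x≈ z≈))

  nextᴾ : ∀ {n} → (e₁ e₂ z y x : Polynomial n) → Polynomial n
  nextᴾ e₁ e₂ z y x = e₁ :* z :- e₂ :* y :+ x

  Δᴾ : ∀ {n} → (x y z : Polynomial n) → Polynomial n
  Δᴾ x y z = y :* y :- x :* z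

  Δ-next-identity : ∀ e₁ e₂ x y z →
    let w = next e₁ e₂ z y x ; v = next e₁ e₂ w z y ; u = next e₁ e₂ v w z
    in Δ w v u ≈ next e₂ e₁ (Δ z w v) (Δ y z w) (Δ x y z)
  Δ-next-identity = solve 5 (λ e₁ e₂ x y z →
    let w = nextᴾ e₁ e₂ z y x ; v = nextᴾ e₁ e₂ w z y ; u = nextᴾ e₁ e₂ v w z
    in Δᴾ w v u := nextᴾ e₂ e₁ (Δᴾ z w v) (Δᴾ y z w) (Δᴾ x y z)) refl

  Recurrent : Carrier → Carrier → Series → Set ℓ
  Recurrent e₁ e₂ b = ∀ n → b (3 ℕ.+ n) ≈ next e₁ e₂ (b (2 ℕ.+ n)) (b (1 ℕ.+ n)) (b n)

  Recurrent-cong : ∀ {e₁ e₂ b b′} → (∀ n → b n ≈ b′ n) → Recurrent e₁ e₂ b → Recurrent e₁ e₂ b′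
  Recurrent-cong b≈b′ rec n =
    trans (sym (b≈b′ (3 ℕ.+ n))) (trans (rec n) (next-cong _ _ (b≈b′ (2 ℕ.+ n)) (b≈b′ (1 ℕ.+ n)) (b≈b′ n)))

  recurrent-unique : ∀ {e₁ e₂ a b} → Recurrent e₁ e₂ a → Recurrent e₁ e₂ b →
                     a 0 ≈ b 0 → a 1 ≈ b 1 → a 2 ≈ b 2 → ∀ n → a n ≈ b n
  recurrent-unique {e₁} {e₂} {a} {b} rec-a rec-b a₀≈ a₁≈ a₂≈ n = proj₁ (agree n)
    where
    agree : ∀ n → (a n ≈ b n) × (a (1 ℕ.+ n) ≈ b (1 ℕ.+ n)) × (a (2 ℕ.+ n) ≈ b (2 ℕ.+ n))
    agree zero = a₀≈ , a₁≈ , a₂≈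
    agree (suc n) with agree n
    ... | aₙ≈ , aₙ₊₁≈ , aₙ₊₂≈ =
      aₙ₊₁≈ , aₙ₊₂≈ , trans (rec-a n) (trans (next-cong e₁ e₂ aₙ₊₂≈ aₙ₊₁≈ aₙ≈) (sym (rec-b n)))

  Δs : Series → Series
  Δs b n = Δ (b n) (b (1 ℕ.+ n)) (b (2 ℕ.+ n))

  Δs-recurrent : ∀ {e₁ e₂ b} → Recurrent e₁ e₂ b → Recurrent e₂ e₁ (Δs b)
  Δs-recurrent {e₁} {e₂} {b} rec n = begin
    Δ w v u                                     ≈⟨ Δ-cong w≈ v≈ u≈ ⟩
    Δ W V U                                     ≈⟨ Δ-next-identity e₁ e₂ x y z ⟩
    next e₂ e₁ (Δ z W V) (Δ y z W) (Δ x y z)    ≈⟨ next-cong e₂ e₁ (Δ-cong refl w≈ v≈) (Δ-cong refl refl w≈) refl ⟨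
    next e₂ e₁ (Δ z w v) (Δ y z w) (Δ x y z)    ∎
    where
    x y z w v u W V U : Carrier
    x = b n
    y = b (1 ℕ.+ n)
    z = b (2 ℕ.+ n)
    w = b (3 ℕ.+ n)
    v = b (4 ℕ.+ n)
    u = b (5 ℕ.+ n)
    W = next e₁ e₂ z y x
    V = next e₁ e₂ W z y
    U = next e₁ e₂ V W z
    w≈ : w ≈ W
    w≈ = rec n
    v≈ : v ≈ V
    v≈ = trans (rec (1 ℕ.+ n)) (next-cong e₁ e₂ w≈ refl refl)
    u≈ : u ≈ U
    u≈ = trans (rec (2 ℕ.+ n)) (next-cong e₁ e₂ v≈ w≈ refl)

  -- The sequence b with a zero prepended: the term of index -1 is 0.
  pad : Series → Series
  pad b zero    = 0#
  pad b (suc n) = b n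

  pad-recurrent : ∀ {e₁ e₂ b} → Recurrent e₁ e₂ b → b 2 ≈ next e₁ e₂ (b 1) (b 0) 0# →
                  Recurrent e₁ e₂ (pad b)
  pad-recurrent rec first zero    = first
  pad-recurrent rec first (suc n) = rec n

  Δ-0 : ∀ y z → Δ 0# y z ≈ y * y
  Δ-0 y z = trans (+-congˡ (trans (-‿cong (zeroˡ z)) -0#≈0#)) (+-identityʳ (y * y))

  Δs-pad² : ∀ a n → Δs (pad (pad a)) n ≈ pad (𝓛 a) n
  Δs-pad² a zero          = trans (Δ-0 0# (a 0)) (zeroˡ 0#)
  Δs-pad² a (suc zero)    = refl
  Δs-pad² a (suc (suc n)) = refl

  next-from-1 : ∀ e₁ e₂ {x} → x ≈ 1# → next e₁ e₂ x 0# 0# ≈ e₁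
  next-from-1 e₁ e₂ {x} x≈1 = begin
    e₁ * x - e₂ * 0# + 0#   ≈⟨ +-identityʳ _ ⟩
    e₁ * x - e₂ * 0#        ≈⟨ +-cong (trans (*-congˡ x≈1) (*-identityʳ e₁)) (trans (-‿cong (zeroʳ e₂)) -0#≈0#) ⟩
    e₁ + 0#                 ≈⟨ +-identityʳ e₁ ⟩
    e₁                      ∎

  -- Used for a₂ = e₁² - e₂ twice: to recover γ, and to get (𝓛a)₁ = e₂.
  square-cancel : ∀ x y → x * x - (x * x - y) ≈ y
  square-cancel = solve 2 (λ x y → x :* x :- (x :* x :- y) := y) refl

  -- a is the coefficient sequence of 1 / (1 - e₁x + e₂x² - x³): with a₋₂ = a₋₁ = 0 it
  -- satisfies the (e₁,e₂)-recurrence, and a₀ = 1.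
  record CoefficientSequence (e₁ e₂ : Carrier) (a : Series) : Set ℓ where
    field
      recurrence : Recurrent e₁ e₂ (pad (pad a))
      initial₀   : a 0 ≈ 1#

    initial₁ : a 1 ≈ e₁
    initial₁ = trans (recurrence 0) (next-from-1 e₁ e₂ initial₀)

    initial₂ : a 2 ≈ e₁ * e₁ - e₂
    initial₂ = begin
      a 2                         ≈⟨ recurrence 1 ⟩
      next e₁ e₂ (a 1) (a 0) 0#   ≈⟨ next-cong e₁ e₂ initial₁ initial₀ refl ⟩
      e₁ * e₁ - e₂ * 1# + 0#      ≈⟨ +-identityʳ _ ⟩
      e₁ * e₁ - e₂ * 1#           ≈⟨ +-congˡ (-‿cong (*-identityʳ e₂)) ⟩
      e₁ * e₁ - e₂                ∎

  coefficientSequence-unique : ∀ {e₁ e₂ a b} → CoefficientSequence e₁ e₂ a → CoefficientSequence e₁ e₂ b →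
                               ∀ n → a n ≈ b n
  coefficientSequence-unique A B n =
    recurrent-unique A.recurrence B.recurrence refl refl (trans A.initial₀ (sym B.initial₀)) (2 ℕ.+ n)
    where
    module A = CoefficientSequence A
    module B = CoefficientSequence B

  𝓛-coefficientSequence : ∀ {e₁ e₂ a} → CoefficientSequence e₁ e₂ a → CoefficientSequence e₂ e₁ (𝓛 a)
  𝓛-coefficientSequence {e₁} {e₂} {a} A = record
    { recurrence = pad-recurrent 𝓛a-recurrent 𝓛a₁-step
    ; initial₀   = 𝓛a₀
    }
    where
    open CoefficientSequence A
    𝓛a-recurrent : Recurrent e₂ e₁ (pad (𝓛 a))
    𝓛a-recurrent = Recurrent-cong (Δs-pad² a) (Δs-recurrent recurrence)
    𝓛a₀ : 𝓛 a 0 ≈ 1#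
    𝓛a₀ = trans (Δ-0 (a 0) (a 1)) (trans (*-cong initial₀ initial₀) (*-identityʳ 1#))
    𝓛a₁ : 𝓛 a 1 ≈ e₂
    𝓛a₁ = begin
      Δ (a 0) (a 1) (a 2)                 ≈⟨ Δ-cong initial₀ initial₁ initial₂ ⟩
      e₁ * e₁ - 1# * (e₁ * e₁ - e₂)       ≈⟨ +-congˡ (-‿cong (*-identityˡ _)) ⟩
      e₁ * e₁ - (e₁ * e₁ - e₂)            ≈⟨ square-cancel e₁ e₂ ⟩
      e₂                                  ∎
    𝓛a₁-step : 𝓛 a 1 ≈ next e₂ e₁ (𝓛 a 0) 0# 0#
    𝓛a₁-step = trans 𝓛a₁ (sym (next-from-1 e₂ e₁ 𝓛a₀))

  sumUpTo-vanishing : ∀ f → (∀ k → f (4 ℕ.+ k) ≈ 0#) → ∀ n → sumUpTo (3 ℕ.+ n) f ≈ sumUpTo 3 f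
  sumUpTo-vanishing f f≈0 zero    = refl
  sumUpTo-vanishing f f≈0 (suc n) = trans (+-cong (sumUpTo-vanishing f f≈0 n) (f≈0 n)) (+-identityʳ _)

  -- Padding terms contributed by the zeros a₋₂, a₋₁.
  plus-times-0 : ∀ x y → x + y * 0# ≈ x
  plus-times-0 x y = trans (+-congˡ (zeroʳ y)) (+-identityʳ x)

  convolution-window : ∀ β γ a n → let b = pad (pad a) in
    (denom β γ ⋆ a) (1 ℕ.+ n) ≈
      ((1# * b (3 ℕ.+ n) + (- β) * b (2 ℕ.+ n)) + (β * β - γ) * b (1 ℕ.+ n)) + (- 1#) * b n
  convolution-window β γ a zero          = sym (trans (plus-times-0 _ _) (plus-times-0 _ _))
  convolution-window β γ a (suc zero)    = sym (plus-times-0 _ _)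
  convolution-window β γ a (suc (suc n)) = sumUpTo-vanishing (λ k → denom β γ k * a ((3 ℕ.+ n) ∸ k)) (λ k → zeroˡ _) n

  solve-leading : ∀ e₁ e₂ X Y Z T → ((1# * X + (- e₁) * Y) + e₂ * Z) + (- 1#) * T ≈ 0# → X ≈ next e₁ e₂ Y Z T
  solve-leading e₁ e₂ X Y Z T coeff≈0 = begin
    X                                ≈⟨ solve 6 (λ e₁ e₂ X Y Z T →
                                           X := nextᴾ e₁ e₂ Y Z T :+ (((X :+ (:- e₁) :* Y) :+ e₂ :* Z) :- T)) refl e₁ e₂ X Y Z T ⟩
    next e₁ e₂ Y Z T + S             ≈⟨ +-congˡ S≈0 ⟩
    next e₁ e₂ Y Z T + 0#            ≈⟨ +-identityʳ _ ⟩
    next e₁ e₂ Y Z T                 ∎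
    where
    S : Carrier
    S = ((X + (- e₁) * Y) + e₂ * Z) - T
    S≈0 : S ≈ 0#
    S≈0 = trans (+-cong (+-congʳ (+-congʳ (sym (*-identityˡ X)))) (sym (-1*x≈-x T))) coeff≈0

  hasGF⇒coefficientSequence : ∀ {β γ a} → HasGF β γ a → CoefficientSequence β (β * β - γ) a
  hasGF⇒coefficientSequence {β} {γ} {a} gf = record
    { recurrence = λ n → solve-leading β (β * β - γ) _ _ _ _ (trans (sym (convolution-window β γ a n)) (gf (1 ℕ.+ n)))
    ; initial₀   = trans (sym (*-identityˡ (a 0))) (gf 0)
    }

theorem4p1 : ∀ {c ℓ : Level} (R : CommutativeRing c ℓ) → let open CommutativeRing R in let open Seq R in (β γ : Carrier) (a : ℕ → Carrier) → HasGF β γ a → (∀ n → 𝓛 (𝓛 a) n ≈ a n) × (a 0 ≈ 1#) × (a 1 ≈ β) × (a 2 ≈ γ)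
theorem4p1 R β γ a gf =
  coefficientSequence-unique (𝓛-coefficientSequence (𝓛-coefficientSequence A)) A ,
  initial₀ , initial₁ , a₂≈γ
  where
  open CommutativeRing R
  open CoefficientSequences R
  A : CoefficientSequence β (β * β - γ) a
  A = hasGF⇒coefficientSequence gf
  open CoefficientSequence A
  a₂≈γ : a 2 ≈ γ
  a₂≈γ = trans initial₂ (square-cancel β γ)
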